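{- For $n\ge 1$ let $S_n$ be the star graph consisting of a central vertex adjacent to $n$ vertices of degree one, with the standard price function ($P\equiv 2$). Then for every fixed integer $t\ge 1$, \[ \lim_{n\to\infty}\frac{\pi^{t+1}(S_n)}{\pi^{t}(S_n)}=1. \]
   Context: A configuration of $k$ pebbles on a graph $G$ is a function $C:V(G)\to\mathbb{Z}_{\ge0}$ with total sum $k$. A pebbling move along an edge $uv$ removes two pebbles from $u$ and adds one pebble to $v$ (allowed only if $u$ has at least two pebbles). A configuration is $t$-solvable if for every set of $t$ vertices some sequence of pebbling moves yields a configuration with at least one pebble on each of those $t$ vertices. $\pi^t(G)$ is the minimum $k$ such that every configuration of $k$ pebbles on $G$ is $t$-solvable. In the paper this is phrased as: the pebbling ratio sequence $\alpha^t(\mathcal{S})$ of the family of star graphs converges to $1$ for all $t$. -}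

module Defs where

open import Data.Nat using (ℕ; zero; suc; _+_; _∸_; _≤_; _<_)
open import Data.Fin using (Fin; zero; suc; _≟_)
open import Data.Fin.Subset using (Subset; _∈_; ∣_∣)
open import Data.Bool using (if_then_else_)
open import Data.Product using (Σ; _×_)
open import Relation.Nullary.Decidable using (⌊_⌋)
open import Relation.Binary.Construct.Closure.ReflexiveTransitive using (Star)
open import Function using (_∘_)

Graph : ℕ → Set₁
Graph m = Fin m → Fin m → Set

-- Star graph S_n: vertex 0 is the centre, vertices suc i (i : Fin n) are the n leaves.
data StarAdj (n : ℕ) : Fin (suc n) → Fin (suc n) → Set where
  centre→leaf : (i : Fin n) → StarAdj n zero (suc i)
  leaf→centre : (i : Fin n) → StarAdj n (suc i) zero

Config : ℕ → Set
Config m = Fin m → ℕ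

size : ∀ {m} → Config m → ℕ
size {zero} C = 0
size {suc m} C = C zero + size (C ∘ suc)

step : ∀ {m} → Config m → Fin m → Fin m → Config m
step C u v w = (if ⌊ w ≟ u ⌋ then C w ∸ 2 else C w) + (if ⌊ w ≟ v ⌋ then 1 else 0)

-- One pebbling move on graph G (standard price P ≡ 2).
data Move {m} (G : Graph m) : Config m → Config m → Set where
  move : (C : Config m) (u v : Fin m) → G u v → 2 ≤ C u → Move G C (step C u v)

Reachable : ∀ {m} → Graph m → Config m → Config m → Set
Reachable G = Star (Move G)

Solvable : ∀ {m} → Graph m → ℕ → Config m → Set
Solvable {m} G t C = (S : Subset m) → ∣ S ∣ ≡ t →
  Σ (Config m) λ D → Reachable G C D × ((v : Fin m) → v ∈ S → 1 ≤ D v)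
  where open import Relation.Binary.PropositionalEquality using (_≡_)

AllSolvable : ∀ {m} → Graph m → ℕ → ℕ → Set
AllSolvable {m} G t k = (C : Config m) → size C ≡ k → Solvable G t C
  where open import Relation.Binary.PropositionalEquality using (_≡_)

IsPebblingNumber : ∀ {m} → Graph m → ℕ → ℕ → Set
IsPebblingNumber G t k = AllSolvable G t k × ((j : ℕ) → j < k → ¬ AllSolvable G t j)
  where open import Relation.Nullary using (¬_)

open import Data.Nat using (_⊔_)
absDiff : ℕ → ℕ → ℕ
absDiff a b = (a ∸ b) ⊔ (b ∸ a)

{-# OPTIONS --safe #-}
-- For n > t ≥ 1 the star S_n has π^t(S_n) = n + 3t − 1, so consecutive pebbling numbers differ
-- by 3 and their ratio tends to 1.
--
-- For a target set, the supply is the number of pebbles on the centre plus, for each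
-- leaf, half of the pebbles it can spare (a target leaf keeps one); the demand is 2 for each empty
-- target leaf plus 1 if the centre is a target. Summing x + 2·shortfall ≤ 2·surplus + 1 + 3·[target]
-- over the leaves gives 2·demand ≤ 2·supply + 1 once there are n + 3t − 1 pebbles. The greedy
-- strategy (send spare pebbles to the centre, otherwise pay 2 centre pebbles into an empty target
-- leaf) keeps demand ≤ supply, and it stops only when the target set is covered.
--
-- Put 4t − 1 pebbles on one non-target leaf, one on every other non-target leaf and
-- none elsewhere. Give a centre pebble weight 1, a target leaf holding x ≥ 1 pebbles weight x + 1
-- and a non-target leaf holding x pebbles weight ⌊x/2⌋. A move out of the centre spends 2 and adds
-- at most 2 to a leaf; a move into the centre gains 1 but costs the leaf at least 1. So the weight,
-- 2t − 1 initially and no more for any subconfiguration, never reaches the 2t needed to cover the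
-- t target leaves.

module Submission where

open import Defs
open import Data.Bool using (Bool; true; false; if_then_else_)
open import Data.Fin using (Fin; zero; suc; _≟_)
open import Data.Fin.Properties using (suc-injective)
open import Data.Fin.Subset using (Subset; _∈_; ∣_∣; outside; ⊤; ⊥)
open import Data.Fin.Subset.Properties using (∣⊥∣≡0)
open import Data.Nat using (ℕ; zero; suc; pred; _+_; _*_; _∸_; _⊓_; _⊔_; _≤_; _<_; z≤n; s≤s; s≤s⁻¹; z<s; ⌊_/2⌋)
open import Data.Nat.Induction using (<-wellFounded)
open import Data.Nat.Properties hiding (_≟_; suc-injective)
open import Data.Nat.Tactic.RingSolver using (solve-∀)
open import Data.Product using (Σ; _×_; _,_; proj₁; proj₂)
open import Data.Vec using (_∷_; []; lookup; _++_; here; there)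
open import Data.Vec.Properties using ([]=⇒lookup)
open import Function using (_∘_)
open import Induction.WellFounded using (Acc; acc)
open import Relation.Binary.Construct.Closure.ReflexiveTransitive using (ε; _◅_)
open import Relation.Binary.PropositionalEquality
open import Relation.Nullary using (¬_; yes; no; contradiction)
open import Relation.Nullary.Decidable using (⌊_⌋)

pointwise≤size : ∀ {m} (C : Config m) v → C v ≤ size C
pointwise≤size C zero = m≤m+n _ _
pointwise≤size C (suc v) = ≤-trans (pointwise≤size (C ∘ suc) v) (m≤n+m _ _)

size-mono : ∀ {m} {C D : Config m} → (∀ v → C v ≤ D v) → size C ≤ size D
size-mono {zero} _ = z≤n
size-mono {suc m} C≤D = +-mono-≤ (C≤D zero) (size-mono (C≤D ∘ suc))

size≡0⇒≡0 : ∀ {m} (C : Config m) → size C ≡ 0 → ∀ v → C v ≡ 0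
size≡0⇒≡0 C eq v = n≤0⇒n≡0 (subst (C v ≤_) eq (pointwise≤size C v))

size>0⇒∃>0 : ∀ {m} (C : Config m) → 0 < size C → Σ (Fin m) λ v → 0 < C v
size>0⇒∃>0 {suc m} C pos with C zero in eq
... | suc _ = zero , subst (0 <_) (sym eq) z<s
... | zero = let v , pos′ = size>0⇒∃>0 (C ∘ suc) pos in suc v , pos′

size-update-≤ : ∀ {m} {C D : Config m} (v : Fin m) {a b : ℕ} →
  (∀ w → w ≢ v → C w ≡ D w) → C v + a ≤ D v + b → size C + a ≤ size D + b
size-update-≤ {suc m} {C} {D} zero {a} {b} agree le = begin
  C zero + size (C ∘ suc) + a  ≡⟨ rearrange (C zero) _ a ⟩
  C zero + a + size (C ∘ suc)  ≤⟨ +-mono-≤ le (size-mono λ w → ≤-reflexive (agree (suc w) λ ())) ⟩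
  D zero + b + size (D ∘ suc)  ≡⟨ rearrange (D zero) b _ ⟩
  D zero + size (D ∘ suc) + b  ∎
  where
  open ≤-Reasoning
  rearrange : ∀ x y z → x + y + z ≡ x + z + y
  rearrange = solve-∀
size-update-≤ {suc m} {C} {D} (suc v) {a} {b} agree le = begin
  C zero + size (C ∘ suc) + a    ≡⟨ +-assoc (C zero) _ a ⟩
  C zero + (size (C ∘ suc) + a)  ≤⟨ +-mono-≤ (≤-reflexive (agree zero λ ()))
                                      (size-update-≤ v (λ w w≢v → agree (suc w) (w≢v ∘ suc-injective)) le) ⟩
  D zero + (size (D ∘ suc) + b)  ≡⟨ +-assoc (D zero) _ b ⟨
  D zero + size (D ∘ suc) + b    ∎
  where open ≤-Reasoning

subconfig : ∀ {m} (C : Config m) {j} → j ≤ size C →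
  Σ (Config m) λ C′ → (∀ v → C′ v ≤ C v) × size C′ ≡ j
subconfig {zero} C z≤n = C , (λ ()) , refl
subconfig {suc m} C {j} j≤size = C′ , C′≤C , size-C′
  where
  rest = size (C ∘ suc)
  tail = subconfig (C ∘ suc) (m⊓n≤m rest j)
  C′ : Config (suc m)
  C′ zero = j ∸ rest
  C′ (suc v) = proj₁ tail v
  C′≤C : ∀ v → C′ v ≤ C v
  C′≤C zero = m≤n+o⇒m∸n≤o j rest (subst (j ≤_) (+-comm (C zero) rest) j≤size)
  C′≤C (suc v) = proj₁ (proj₂ tail) v
  size-C′ : size C′ ≡ j
  size-C′ = trans (cong (j ∸ rest +_) (proj₂ (proj₂ tail)))
                  (trans (+-comm (j ∸ rest) (rest ⊓ j)) (m⊓n+n∸m≡n rest j))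

step-other : ∀ {m} (C : Config m) {u v w : Fin m} → w ≢ u → w ≢ v → step C u v w ≡ C w
step-other C {u} {v} {w} w≢u w≢v with w ≟ u | w ≟ v
... | yes w≡u | _       = contradiction w≡u w≢u
... | no _    | yes w≡v = contradiction w≡v w≢v
... | no _    | no _    = +-identityʳ (C w)

step-source : ∀ {m} (C : Config m) {u v : Fin m} → u ≢ v → step C u v u ≡ C u ∸ 2
step-source C {u} {v} u≢v with u ≟ u | u ≟ v
... | no u≢u | _       = contradiction refl u≢u
... | yes _  | yes u≡v = contradiction u≡v u≢v
... | yes _  | no _    = +-identityʳ (C u ∸ 2)

step-target : ∀ {m} (C : Config m) {u v : Fin m} → u ≢ v → step C u v v ≡ suc (C v)
step-target C {u} {v} u≢v with v ≟ u | v ≟ v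
... | yes v≡u | _      = contradiction (sym v≡u) u≢v
... | no _    | no v≢v = contradiction refl v≢v
... | no _    | yes _  = +-comm (C v) 1

size-step : ∀ {m} (C : Config m) {u} v → 2 ≤ C u → size (step C u v) < size C
size-step C {u} v 2≤Cu = begin-strict
  size (step C u v)      ≡⟨ +-identityʳ _ ⟨
  size (step C u v) + 0  ≤⟨ size-update-≤ v added-off-v added-at-v ⟩
  size taken + 1         <⟨ +-monoʳ-< (size taken) (n<1+n 1) ⟩
  size taken + 2         ≤⟨ size-update-≤ u taken-off-u taken-at-u ⟩
  size C + 0             ≡⟨ +-identityʳ _ ⟩
  size C                 ∎
  where
  open ≤-Reasoning
  taken : Config _
  taken w = if ⌊ w ≟ u ⌋ then C w ∸ 2 else C w
  added-off-v : ∀ w → w ≢ v → step C u v w ≡ taken w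
  added-off-v w w≢v with w ≟ v
  ... | yes w≡v = contradiction w≡v w≢v
  ... | no _    = +-identityʳ (taken w)
  added-at-v : step C u v v + 0 ≤ taken v + 1
  added-at-v with v ≟ v
  ... | yes _  = ≤-reflexive (+-identityʳ _)
  ... | no v≢v = contradiction refl v≢v
  taken-off-u : ∀ w → w ≢ u → taken w ≡ C w
  taken-off-u w w≢u with w ≟ u
  ... | yes w≡u = contradiction w≡u w≢u
  ... | no _    = refl
  taken-at-u : taken u + 2 ≤ C u + 0
  taken-at-u with u ≟ u
  ... | yes _  = ≤-reflexive (trans (m∸n+n≡m 2≤Cu) (sym (+-identityʳ _)))
  ... | no u≢u = contradiction refl u≢u

size-move : ∀ {m} {G : Graph m} {C C′ : Config m} → Move G C C′ → size C′ < size C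
size-move (move C u v _ 2≤Cu) = size-step C v 2≤Cu

Covers : ∀ {m} → Subset m → Config m → Set
Covers T D = ∀ v → v ∈ T → 1 ≤ D v

Coverable : ∀ {m} → Graph m → Subset m → Config m → Set
Coverable {m} G T C = Σ (Config m) λ D → Reachable G C D × Covers T D

coverable-move : ∀ {m} {G : Graph m} {T : Subset m} {C C′ : Config m} →
  Move G C C′ → Coverable G T C′ → Coverable G T C
coverable-move C→C′ (D , C′⇝D , covers) = D , C→C′ ◅ C′⇝D , covers

uncoverable⇒¬AllSolvable : ∀ {m} {G : Graph m} {T : Subset m} {j} (C : Config m) → j ≤ size C →
  (∀ C′ → (∀ v → C′ v ≤ C v) → ¬ Coverable G T C′) → ¬ AllSolvable G ∣ T ∣ j
uncoverable⇒¬AllSolvable {T = T} C j≤size uncoverable solvable with subconfig C j≤size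
... | C′ , C′≤C , size≡j = uncoverable C′ C′≤C (solvable C′ size≡j T refl)

gather-other : ∀ {n} (C : Config (suc n)) {i k : Fin n} → k ≢ i → step C (suc i) zero (suc k) ≡ C (suc k)
gather-other C {i} k≢i = step-other C {suc i} {zero} (k≢i ∘ suc-injective) λ ()

deliver-other : ∀ {n} (C : Config (suc n)) {i k : Fin n} → k ≢ i → step C zero (suc i) (suc k) ≡ C (suc k)
deliver-other C {i} k≢i = step-other C {zero} {suc i} (λ ()) (k≢i ∘ suc-injective)

weightedSum : ∀ {n} → (Fin n → ℕ → ℕ) → (Fin n → ℕ) → ℕ
weightedSum w L = size λ i → w i (L i)

weightedSum-update-≤ : ∀ {n} (w : Fin n → ℕ → ℕ) {L L′ : Fin n → ℕ} (i : Fin n) {a b : ℕ} →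
  (∀ k → k ≢ i → L′ k ≡ L k) → w i (L′ i) + a ≤ w i (L i) + b → weightedSum w L′ + a ≤ weightedSum w L + b
weightedSum-update-≤ w i agree = size-update-≤ i λ k k≢i → cong (w k) (agree k k≢i)

weightedSum-update-mono : ∀ {n} (w : Fin n → ℕ → ℕ) {L L′ : Fin n → ℕ} (i : Fin n) →
  (∀ k → k ≢ i → L′ k ≡ L k) → w i (L′ i) ≤ w i (L i) → weightedSum w L′ ≤ weightedSum w L
weightedSum-update-mono w i agree le =
  +-cancelʳ-≤ 0 _ _ (weightedSum-update-≤ w i agree (+-monoˡ-≤ 0 le))

weightedSum-mono : ∀ {n} (w : Fin n → ℕ → ℕ) → (∀ i {x y} → x ≤ y → w i x ≤ w i y) →
  ∀ {L L′ : Fin n → ℕ} → (∀ i → L′ i ≤ L i) → weightedSum w L′ ≤ weightedSum w L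
weightedSum-mono w w-mono L′≤L = size-mono λ i → w-mono i (L′≤L i)

-- Upper bound: supply, demand and the greedy strategy

fromBool : Bool → ℕ
fromBool true = 1
fromBool false = 0

∣∷∣ : ∀ {n} b (S : Subset n) → ∣ b ∷ S ∣ ≡ fromBool b + ∣ S ∣
∣∷∣ true S = refl
∣∷∣ false S = refl

m≤2⌊m/2⌋+1 : ∀ m → m ≤ 2 * ⌊ m /2⌋ + 1
m≤2⌊m/2⌋+1 zero = z≤n
m≤2⌊m/2⌋+1 (suc zero) = ≤-refl
m≤2⌊m/2⌋+1 (suc (suc m)) =
  subst (suc (suc m) ≤_) (cong (_+ 1) (sym (*-suc 2 ⌊ m /2⌋))) (s≤s (s≤s (m≤2⌊m/2⌋+1 m)))

2*m≤2*n+1⇒m≤n : ∀ {m n} → 2 * m ≤ 2 * n + 1 → m ≤ n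
2*m≤2*n+1⇒m≤n {m} {n} le = s≤s⁻¹ (*-cancelˡ-< 2 m (suc n) (begin-strict
  2 * m          ≤⟨ le ⟩
  2 * n + 1      ≡⟨ +-comm (2 * n) 1 ⟩
  suc (2 * n)    <⟨ n<1+n _ ⟩
  2 + 2 * n      ≡⟨ *-suc 2 n ⟨
  2 * suc n      ∎))
  where open ≤-Reasoning

surplus : Bool → ℕ → ℕ
surplus true x = ⌊ pred x /2⌋
surplus false x = ⌊ x /2⌋

shortfall : Bool → ℕ → ℕ
shortfall true zero = 2
shortfall true (suc _) = 0
shortfall false _ = 0

supply : ∀ {n} → Subset n → Config (suc n) → ℕ
supply S C = C zero + weightedSum (surplus ∘ lookup S) (C ∘ suc)

demand : ∀ {n} → Bool → Subset n → Config (suc n) → ℕ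
demand b S C = fromBool b + weightedSum (shortfall ∘ lookup S) (C ∘ suc)

surplus>0⇒2≤ : ∀ b x → 1 ≤ surplus b x → 2 ≤ x
surplus>0⇒2≤ true (suc (suc (suc _))) _ = s≤s (s≤s z≤n)
surplus>0⇒2≤ false (suc (suc _)) _ = s≤s (s≤s z≤n)
surplus>0⇒2≤ true zero ()
surplus>0⇒2≤ true (suc zero) ()
surplus>0⇒2≤ true (suc (suc zero)) ()
surplus>0⇒2≤ false zero ()
surplus>0⇒2≤ false (suc zero) ()

surplus-suc : ∀ b x → surplus b x ≤ surplus b (suc x)
surplus-suc true x = ⌊n/2⌋-mono (pred-mono-≤ (n≤1+n x))
surplus-suc false x = ⌊n/2⌋-mono (n≤1+n x)

surplus-∸2 : ∀ b x → surplus b x ≤ surplus b (x ∸ 2) + 1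
surplus-∸2 true (suc (suc (suc x))) = ≤-reflexive (+-comm 1 ⌊ x /2⌋)
surplus-∸2 false (suc (suc x)) = ≤-reflexive (+-comm 1 ⌊ x /2⌋)
surplus-∸2 true zero = z≤n
surplus-∸2 true (suc zero) = z≤n
surplus-∸2 true (suc (suc zero)) = z≤n
surplus-∸2 false zero = z≤n
surplus-∸2 false (suc zero) = z≤n

shortfall-∸2 : ∀ b x → 1 ≤ surplus b x → shortfall b (x ∸ 2) ≤ shortfall b x
shortfall-∸2 true (suc (suc (suc _))) _ = z≤n
shortfall-∸2 false _ _ = z≤n
shortfall-∸2 true zero ()
shortfall-∸2 true (suc zero) ()
shortfall-∸2 true (suc (suc zero)) ()

shortfall>0⇒empty-target : ∀ b x → 0 < shortfall b x → b ≡ true × x ≡ 0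
shortfall>0⇒empty-target true zero _ = refl , refl

shortfall≡0⇒nonempty : ∀ {b x} → b ≡ true → shortfall b x ≡ 0 → 1 ≤ x
shortfall≡0⇒nonempty {x = suc _} refl _ = s≤s z≤n

+-2*-interchange : ∀ x y d e → x + y + 2 * (d + e) ≡ (x + 2 * d) + (y + 2 * e)
+-2*-interchange = solve-∀

leaf-count : ∀ b x → x + 2 * shortfall b x ≤ 2 * surplus b x + 1 + 3 * fromBool b
leaf-count true zero = ≤-refl
leaf-count true (suc x) = begin
  suc x + 0                  ≡⟨ +-identityʳ _ ⟩
  suc x                      ≤⟨ s≤s (m≤2⌊m/2⌋+1 x) ⟩
  suc (2 * ⌊ x /2⌋ + 1)      ≡⟨ +-comm 1 _ ⟩
  2 * ⌊ x /2⌋ + 1 + 1        ≤⟨ +-monoʳ-≤ (2 * ⌊ x /2⌋ + 1) (s≤s z≤n) ⟩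
  2 * ⌊ x /2⌋ + 1 + 3        ∎
  where open ≤-Reasoning
leaf-count false x = subst₂ _≤_ (sym (+-identityʳ x)) (sym (+-identityʳ _)) (m≤2⌊m/2⌋+1 x)

centre-count : ∀ b x → x + 2 * fromBool b ≤ 2 * x + 3 * fromBool b
centre-count b x = +-mono-≤ (m≤m+n x (x + 0)) (*-monoˡ-≤ (fromBool b) (n≤1+n 2))

leaves-count : ∀ {n} (S : Subset n) (L : Fin n → ℕ) →
  size L + 2 * weightedSum (shortfall ∘ lookup S) L ≤ 2 * weightedSum (surplus ∘ lookup S) L + n + 3 * ∣ S ∣
leaves-count [] L = z≤n
leaves-count {suc n} (b ∷ S) L = begin
  L zero + size (L ∘ suc) + 2 * (d + D)            ≡⟨ +-2*-interchange (L zero) (size (L ∘ suc)) d D ⟩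
  (L zero + 2 * d) + (size (L ∘ suc) + 2 * D)      ≤⟨ +-mono-≤ (leaf-count b (L zero)) (leaves-count S (L ∘ suc)) ⟩
  (2 * r + 1 + 3 * fromBool b) + (2 * R + n + 3 * ∣ S ∣) ≡⟨ collect r R n (fromBool b) ∣ S ∣ ⟩
  2 * (r + R) + suc n + 3 * (fromBool b + ∣ S ∣)   ≡⟨ cong (λ k → 2 * (r + R) + suc n + 3 * k) (∣∷∣ b S) ⟨
  2 * (r + R) + suc n + 3 * ∣ b ∷ S ∣              ∎
  where
  open ≤-Reasoning
  d = shortfall b (L zero)
  D = weightedSum (shortfall ∘ lookup S) (L ∘ suc)
  r = surplus b (L zero)
  R = weightedSum (surplus ∘ lookup S) (L ∘ suc)
  collect : ∀ r R n f s → (2 * r + 1 + 3 * f) + (2 * R + n + 3 * s) ≡ 2 * (r + R) + suc n + 3 * (f + s)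
  collect = solve-∀

demand≤supply : ∀ {n} s b (S : Subset n) (C : Config (suc n)) →
  size C ≡ n + 3 * s + 2 → ∣ b ∷ S ∣ ≡ suc s → demand b S C ≤ supply S C
demand≤supply {n} s b S C size≡ ∣T∣≡ = 2*m≤2*n+1⇒m≤n (+-cancelˡ-≤ (n + 3 * s + 2) _ _ (begin
  n + 3 * s + 2 + 2 * demand b S C                       ≡⟨ cong (_+ 2 * demand b S C) size≡ ⟨
  C zero + size (C ∘ suc) + 2 * (fromBool b + D)          ≡⟨ +-2*-interchange (C zero) (size (C ∘ suc)) (fromBool b) D ⟩
  (C zero + 2 * fromBool b) + (size (C ∘ suc) + 2 * D)    ≤⟨ +-mono-≤ (centre-count b (C zero)) (leaves-count S (C ∘ suc)) ⟩
  (2 * C zero + 3 * fromBool b) + (2 * R + n + 3 * ∣ S ∣) ≡⟨ collect (C zero) R n (fromBool b) ∣ S ∣ ⟩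
  2 * supply S C + n + 3 * (fromBool b + ∣ S ∣)           ≡⟨ cong (λ k → 2 * supply S C + n + 3 * k) (trans (sym (∣∷∣ b S)) ∣T∣≡) ⟩
  2 * supply S C + n + 3 * suc s                          ≡⟨ tidy (supply S C) n s ⟩
  n + 3 * s + 2 + (2 * supply S C + 1)                    ∎))
  where
  open ≤-Reasoning
  D = weightedSum (shortfall ∘ lookup S) (C ∘ suc)
  R = weightedSum (surplus ∘ lookup S) (C ∘ suc)
  collect : ∀ c R n f s → (2 * c + 3 * f) + (2 * R + n + 3 * s) ≡ 2 * (c + R) + n + 3 * (f + s)
  collect = solve-∀
  tidy : ∀ p n s → 2 * p + n + 3 * suc s ≡ n + 3 * s + 2 + (2 * p + 1)
  tidy = solve-∀

gather-supply : ∀ {n} (S : Subset n) (C : Config (suc n)) (j : Fin n) →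
  supply S C ≤ supply S (step C (suc j) zero)
gather-supply S C j = begin
  C zero + R               ≡⟨ cong (C zero +_) (+-identityʳ R) ⟨
  C zero + (R + 0)         ≤⟨ +-monoʳ-≤ (C zero) (weightedSum-update-≤ (surplus ∘ lookup S) j
                                (λ k k≢j → sym (gather-other C k≢j)) leaf) ⟩
  C zero + (R′ + 1)        ≡⟨ trans (cong (C zero +_) (+-comm R′ 1)) (+-suc (C zero) R′) ⟩
  suc (C zero) + R′        ≡⟨ cong (_+ R′) (step-target C {suc j} {zero} λ ()) ⟨
  supply S (step C (suc j) zero) ∎
  where
  open ≤-Reasoning
  R = weightedSum (surplus ∘ lookup S) (C ∘ suc)
  R′ = weightedSum (surplus ∘ lookup S) (step C (suc j) zero ∘ suc)
  leaf : surplus (lookup S j) (C (suc j)) + 0 ≤ surplus (lookup S j) (step C (suc j) zero (suc j)) + 1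
  leaf rewrite step-source C {suc j} {zero} (λ ()) | +-identityʳ (surplus (lookup S j) (C (suc j))) =
    surplus-∸2 (lookup S j) (C (suc j))

gather-demand : ∀ {n} b (S : Subset n) (C : Config (suc n)) (j : Fin n) →
  1 ≤ surplus (lookup S j) (C (suc j)) → demand b S (step C (suc j) zero) ≤ demand b S C
gather-demand b S C j pos = +-monoʳ-≤ (fromBool b)
  (weightedSum-update-mono (shortfall ∘ lookup S) j (λ k → gather-other C) leaf)
  where
  leaf : shortfall (lookup S j) (step C (suc j) zero (suc j)) ≤ shortfall (lookup S j) (C (suc j))
  leaf rewrite step-source C {suc j} {zero} (λ ()) = shortfall-∸2 (lookup S j) (C (suc j)) pos

deliver-supply : ∀ {n} (S : Subset n) (C : Config (suc n)) (i : Fin n) → 2 ≤ C zero →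
  supply S C ≤ supply S (step C zero (suc i)) + 2
deliver-supply S C i 2≤C0 = begin
  C zero + R               ≡⟨ cong (_+ R) (m∸n+n≡m 2≤C0) ⟨
  C zero ∸ 2 + 2 + R       ≡⟨ trans (+-assoc (C zero ∸ 2) 2 R) (cong (C zero ∸ 2 +_) (+-comm 2 R)) ⟩
  C zero ∸ 2 + (R + 2)     ≡⟨ +-assoc (C zero ∸ 2) R 2 ⟨
  C zero ∸ 2 + R + 2       ≤⟨ +-monoˡ-≤ 2 (+-monoʳ-≤ (C zero ∸ 2)
                                (weightedSum-update-mono (surplus ∘ lookup S) i (λ k k≢i → sym (deliver-other C k≢i)) leaf)) ⟩
  C zero ∸ 2 + R′ + 2      ≡⟨ cong (λ c → c + R′ + 2) (step-source C {zero} {suc i} λ ()) ⟨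
  supply S (step C zero (suc i)) + 2 ∎
  where
  open ≤-Reasoning
  R = weightedSum (surplus ∘ lookup S) (C ∘ suc)
  R′ = weightedSum (surplus ∘ lookup S) (step C zero (suc i) ∘ suc)
  leaf : surplus (lookup S i) (C (suc i)) ≤ surplus (lookup S i) (step C zero (suc i) (suc i))
  leaf rewrite step-target C {zero} {suc i} (λ ()) = surplus-suc (lookup S i) (C (suc i))

deliver-demand : ∀ {n} b (S : Subset n) (C : Config (suc n)) (i : Fin n) →
  lookup S i ≡ true → C (suc i) ≡ 0 → demand b S (step C zero (suc i)) + 2 ≤ demand b S C
deliver-demand b S C i target empty = begin
  fromBool b + D′ + 2      ≡⟨ +-assoc (fromBool b) D′ 2 ⟩
  fromBool b + (D′ + 2)    ≤⟨ +-monoʳ-≤ (fromBool b) (weightedSum-update-≤ (shortfall ∘ lookup S) i (λ k → deliver-other C) leaf) ⟩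
  fromBool b + (D + 0)     ≡⟨ cong (fromBool b +_) (+-identityʳ D) ⟩
  demand b S C             ∎
  where
  open ≤-Reasoning
  D = weightedSum (shortfall ∘ lookup S) (C ∘ suc)
  D′ = weightedSum (shortfall ∘ lookup S) (step C zero (suc i) ∘ suc)
  leaf : shortfall (lookup S i) (step C zero (suc i) (suc i)) + 2 ≤ shortfall (lookup S i) (C (suc i)) + 0
  leaf rewrite step-target C {zero} {suc i} (λ ()) | target | empty = ≤-refl

data GreedyStep {n} (b : Bool) (S : Subset n) (C : Config (suc n)) : Set where
  covered : Covers (b ∷ S) C → GreedyStep b S C
  gather  : (j : Fin n) → 1 ≤ surplus (lookup S j) (C (suc j)) → GreedyStep b S C
  deliver : (i : Fin n) → lookup S i ≡ true → C (suc i) ≡ 0 → 2 ≤ C zero → GreedyStep b S C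

greedyStep : ∀ {n} b (S : Subset n) (C : Config (suc n)) → demand b S C ≤ supply S C → GreedyStep b S C
greedyStep b S C inv with weightedSum (surplus ∘ lookup S) (C ∘ suc) in surplus≡
... | suc _ with size>0⇒∃>0 _ (subst (0 <_) (sym surplus≡) z<s)
...   | j , pos = gather j pos
greedyStep b S C inv | zero with weightedSum (shortfall ∘ lookup S) (C ∘ suc) in shortfall≡
... | suc k with size>0⇒∃>0 _ (subst (0 <_) (sym shortfall≡) z<s)
...   | i , pos with shortfall>0⇒empty-target (lookup S i) (C (suc i)) pos
...     | target , empty = deliver i target empty (begin
  2                                      ≡⟨ cong₂ shortfall target empty ⟨
  shortfall (lookup S i) (C (suc i))     ≤⟨ pointwise≤size _ i ⟩
  weightedSum (shortfall ∘ lookup S) (C ∘ suc) ≡⟨ shortfall≡ ⟩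
  suc k                                  ≤⟨ m≤n+m (suc k) (fromBool b) ⟩
  fromBool b + suc k                     ≤⟨ inv ⟩
  C zero + 0                             ≡⟨ +-identityʳ (C zero) ⟩
  C zero                                 ∎)
  where open ≤-Reasoning
greedyStep b S C inv | zero | zero = covered covers
  where
  covers : Covers (b ∷ S) C
  covers zero z∈T = +-cancelʳ-≤ 0 1 (C zero) (subst (λ c → fromBool c + 0 ≤ C zero + 0) ([]=⇒lookup z∈T) inv)
  covers (suc i) i∈T = shortfall≡0⇒nonempty ([]=⇒lookup i∈T) (size≡0⇒≡0 _ shortfall≡ i)

greedy : ∀ {n} b (S : Subset n) (C : Config (suc n)) → Acc _<_ (size C) →
  demand b S C ≤ supply S C → Coverable (StarAdj n) (b ∷ S) C
greedy b S C (acc smaller) inv with greedyStep b S C inv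
... | covered covers = C , ε , covers
... | gather j pos = coverable-move gathering
        (greedy b S _ (smaller (size-move gathering))
          (≤-trans (gather-demand b S C j pos) (≤-trans inv (gather-supply S C j))))
  where gathering = move C (suc j) zero (leaf→centre j) (surplus>0⇒2≤ (lookup S j) _ pos)
... | deliver i target empty 2≤C0 = coverable-move delivering
        (greedy b S _ (smaller (size-move delivering))
          (+-cancelʳ-≤ 2 _ _ (≤-trans (deliver-demand b S C i target empty)
                                (≤-trans inv (deliver-supply S C i 2≤C0)))))
  where delivering = move C zero (suc i) (centre→leaf i) 2≤C0

star-solvable : ∀ n s → AllSolvable (StarAdj n) (suc s) (n + 3 * s + 2)
star-solvable n s C size≡ (b ∷ S) ∣T∣≡ = greedy b S C (<-wellFounded _) (demand≤supply s b S C size≡ ∣T∣≡)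

-- Lower bound: a weight that no move increases

worth : Bool → ℕ → ℕ
worth true zero = 0
worth true (suc x) = suc (suc x)
worth false x = ⌊ x /2⌋

weight : ∀ {n} → Subset n → Config (suc n) → ℕ
weight S C = C zero + weightedSum (worth ∘ lookup S) (C ∘ suc)

worth-suc : ∀ b x → worth b (suc x) + 0 ≤ worth b x + 2
worth-suc true zero = ≤-refl
worth-suc true (suc x) = ≤-trans (≤-reflexive (+-identityʳ _)) (≤-trans (n≤1+n _) (≤-reflexive (+-comm 2 _)))
worth-suc false x = begin
  ⌊ suc x /2⌋ + 0        ≡⟨ +-identityʳ _ ⟩
  ⌊ suc x /2⌋            ≤⟨ ⌊n/2⌋-mono (n≤1+n (suc x)) ⟩
  suc ⌊ x /2⌋            ≤⟨ n≤1+n _ ⟩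
  2 + ⌊ x /2⌋            ≡⟨ +-comm 2 _ ⟩
  ⌊ x /2⌋ + 2            ∎
  where open ≤-Reasoning

worth-∸2 : ∀ b x → 2 ≤ x → worth b (x ∸ 2) + 1 ≤ worth b x + 0
worth-∸2 true (suc (suc zero)) _ = s≤s z≤n
worth-∸2 true (suc (suc (suc x))) _ = ≤-trans (≤-reflexive (+-comm _ 1)) (≤-trans (n≤1+n _) (≤-reflexive (sym (+-identityʳ _))))
worth-∸2 false (suc (suc x)) _ = ≤-reflexive (trans (+-comm _ 1) (sym (+-identityʳ _)))
worth-∸2 _ (suc zero) (s≤s ())

worth-mono : ∀ b {x y} → x ≤ y → worth b x ≤ worth b y
worth-mono true z≤n = z≤n
worth-mono true (s≤s x≤y) = s≤s (s≤s x≤y)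
worth-mono false x≤y = ⌊n/2⌋-mono x≤y

leaves-worth : ∀ {n} (S : Subset n) (L : Fin n → ℕ) → (∀ i → i ∈ S → 1 ≤ L i) →
  2 * ∣ S ∣ ≤ weightedSum (worth ∘ lookup S) L
leaves-worth [] L covers = z≤n
leaves-worth (true ∷ S) L covers with L zero | covers zero here
... | suc x | _ = begin
  2 * suc ∣ S ∣                                       ≡⟨ *-suc 2 ∣ S ∣ ⟩
  2 + 2 * ∣ S ∣                                       ≤⟨ +-monoʳ-≤ 2 (≤-trans (leaves-worth S (L ∘ suc) (λ i → covers (suc i) ∘ there)) (m≤n+m _ x)) ⟩
  2 + (x + weightedSum (worth ∘ lookup S) (L ∘ suc))  ∎
  where open ≤-Reasoning
leaves-worth (false ∷ S) L covers =
  ≤-trans (leaves-worth S (L ∘ suc) (λ i → covers (suc i) ∘ there)) (m≤n+m _ _)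

weight-covers : ∀ {n} b (S : Subset n) (D : Config (suc n)) → Covers (b ∷ S) D → 2 * ∣ S ∣ ≤ weight S D
weight-covers b S D covers = ≤-trans (leaves-worth S (D ∘ suc) (λ i → covers (suc i) ∘ there)) (m≤n+m _ (D zero))

weight-move : ∀ {n} (S : Subset n) {C C′ : Config (suc n)} → Move (StarAdj n) C C′ → weight S C′ ≤ weight S C
weight-move S (move C .zero .(suc i) (centre→leaf i) 2≤C0) = begin
  step C zero (suc i) zero + W′  ≡⟨ cong (_+ W′) (step-source C {zero} {suc i} λ ()) ⟩
  C zero ∸ 2 + W′                ≡⟨ cong (C zero ∸ 2 +_) (+-identityʳ W′) ⟨
  C zero ∸ 2 + (W′ + 0)          ≤⟨ +-monoʳ-≤ (C zero ∸ 2) (weightedSum-update-≤ (worth ∘ lookup S) i (λ k → deliver-other C) leaf) ⟩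
  C zero ∸ 2 + (W + 2)           ≡⟨ trans (+-assoc (C zero ∸ 2) 2 W) (cong (C zero ∸ 2 +_) (+-comm 2 W)) ⟨
  C zero ∸ 2 + 2 + W             ≡⟨ cong (_+ W) (m∸n+n≡m 2≤C0) ⟩
  C zero + W                     ∎
  where
  open ≤-Reasoning
  W = weightedSum (worth ∘ lookup S) (C ∘ suc)
  W′ = weightedSum (worth ∘ lookup S) (step C zero (suc i) ∘ suc)
  leaf : worth (lookup S i) (step C zero (suc i) (suc i)) + 0 ≤ worth (lookup S i) (C (suc i)) + 2
  leaf rewrite step-target C {zero} {suc i} (λ ()) = worth-suc (lookup S i) (C (suc i))
weight-move S (move C .(suc j) .zero (leaf→centre j) 2≤Cj) = begin
  step C (suc j) zero zero + W′  ≡⟨ cong (_+ W′) (step-target C {suc j} {zero} λ ()) ⟩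
  suc (C zero) + W′              ≡⟨ trans (cong (C zero +_) (+-comm W′ 1)) (+-suc (C zero) W′) ⟨
  C zero + (W′ + 1)              ≤⟨ +-monoʳ-≤ (C zero) (weightedSum-update-≤ (worth ∘ lookup S) j (λ k → gather-other C) leaf) ⟩
  C zero + (W + 0)               ≡⟨ cong (C zero +_) (+-identityʳ W) ⟩
  C zero + W                     ∎
  where
  open ≤-Reasoning
  W = weightedSum (worth ∘ lookup S) (C ∘ suc)
  W′ = weightedSum (worth ∘ lookup S) (step C (suc j) zero ∘ suc)
  leaf : worth (lookup S j) (step C (suc j) zero (suc j)) + 1 ≤ worth (lookup S j) (C (suc j)) + 0
  leaf rewrite step-source C {suc j} {zero} (λ ()) = worth-∸2 (lookup S j) (C (suc j)) 2≤Cj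

weight-reachable : ∀ {n} (S : Subset n) {C D : Config (suc n)} → Reachable (StarAdj n) C D → weight S D ≤ weight S C
weight-reachable S ε = ≤-refl
weight-reachable S (C→C′ ◅ C′⇝D) = ≤-trans (weight-reachable S C′⇝D) (weight-move S C→C′)

weight-mono : ∀ {n} (S : Subset n) {C C′ : Config (suc n)} → (∀ v → C′ v ≤ C v) → weight S C′ ≤ weight S C
weight-mono S C′≤C = +-mono-≤ (C′≤C zero) (weightedSum-mono _ (λ i → worth-mono (lookup S i)) (C′≤C ∘ suc))

onesOutside : ∀ {n} → Subset n → Fin n → ℕ
onesOutside S i = if lookup S i then 0 else 1

size-onesOutside : ∀ {n} (S : Subset n) → size (onesOutside S) + ∣ S ∣ ≡ n
size-onesOutside [] = refl
size-onesOutside (true ∷ S) = trans (+-suc _ ∣ S ∣) (cong suc (size-onesOutside S))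
size-onesOutside (false ∷ S) = cong suc (size-onesOutside S)

weight-onesOutside : ∀ {n} (S : Subset n) → weightedSum (worth ∘ lookup S) (onesOutside S) ≡ 0
weight-onesOutside [] = refl
weight-onesOutside (true ∷ S) = weight-onesOutside S
weight-onesOutside (false ∷ S) = weight-onesOutside S

heapConfig : ∀ {n} → Subset n → ℕ → Config (suc (suc n))
heapConfig S h zero = 0
heapConfig S h (suc zero) = h
heapConfig S h (suc (suc i)) = onesOutside S i

heapConfig-uncoverable : ∀ {n} (S : Subset n) k → k < 2 * ∣ S ∣ →
  ∀ C → (∀ v → C v ≤ heapConfig S (suc (k + k)) v) → ¬ Coverable (StarAdj (suc n)) (outside ∷ outside ∷ S) C
heapConfig-uncoverable S k k<2∣S∣ C C≤heap (D , C⇝D , covers) = <⇒≱ k<2∣S∣ (begin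
  2 * ∣ S ∣                                         ≤⟨ weight-covers outside (outside ∷ S) D covers ⟩
  weight (outside ∷ S) D                            ≤⟨ weight-reachable (outside ∷ S) C⇝D ⟩
  weight (outside ∷ S) C                            ≤⟨ weight-mono (outside ∷ S) C≤heap ⟩
  ⌊ suc (k + k) /2⌋ + weightedSum (worth ∘ lookup S) (onesOutside S) ≡⟨ cong (⌊ suc (k + k) /2⌋ +_) (weight-onesOutside S) ⟩
  ⌊ suc (k + k) /2⌋ + 0                             ≡⟨ trans (+-identityʳ _) (sym (n≡⌈n+n/2⌉ k)) ⟩
  k                                                 ∎)
  where open ≤-Reasoning

∣⊤++⊥∣ : ∀ t r → ∣ ⊤ {t} ++ ⊥ {r} ∣ ≡ t
∣⊤++⊥∣ zero r = ∣⊥∣≡0 r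
∣⊤++⊥∣ (suc t) r = cong suc (∣⊤++⊥∣ t r)

star-unsolvable : ∀ s r j → j < suc (suc s) + r + 3 * s + 2 → ¬ AllSolvable (StarAdj (suc (suc s) + r)) (suc s) j
star-unsolvable s r j j<bound = subst (λ t → ¬ AllSolvable (StarAdj (suc (suc s) + r)) t j) ∣S∣≡1+s
  (uncoverable⇒¬AllSolvable (heapConfig S h) j≤size (heapConfig-uncoverable S k k<2∣S∣))
  where
  S = ⊤ {suc s} ++ ⊥ {r}
  k = suc (s + s)
  h = suc (k + k)
  ∣S∣≡1+s : ∣ S ∣ ≡ suc s
  ∣S∣≡1+s = ∣⊤++⊥∣ (suc s) r
  k<2∣S∣ : k < 2 * ∣ S ∣
  k<2∣S∣ = ≤-reflexive (trans (double-suc s) (cong (2 *_) (sym ∣S∣≡1+s)))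
    where
    double-suc : ∀ s → suc (suc (s + s)) ≡ 2 * suc s
    double-suc = solve-∀
  size-ones : size (onesOutside S) ≡ r
  size-ones = +-cancelʳ-≡ ∣ S ∣ _ r (begin
    size (onesOutside S) + ∣ S ∣  ≡⟨ size-onesOutside S ⟩
    suc s + r                     ≡⟨ +-comm (suc s) r ⟩
    r + suc s                     ≡⟨ cong (r +_) ∣S∣≡1+s ⟨
    r + ∣ S ∣                     ∎)
    where open ≡-Reasoning
  j≤size : j ≤ size (heapConfig S h)
  j≤size = begin
    j                              ≤⟨ s≤s⁻¹ (≤-trans j<bound (≤-reflexive (bound≡ s r))) ⟩
    h + r                          ≡⟨ cong (h +_) size-ones ⟨
    h + size (onesOutside S)       ∎
    where
    open ≤-Reasoning
    bound≡ : ∀ s r → suc (suc s) + r + 3 * s + 2 ≡ suc (suc (suc (s + s) + suc (s + s)) + r)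
    bound≡ = solve-∀

star-pebbling : ∀ {n} s → suc s < n → IsPebblingNumber (StarAdj n) (suc s) (n + 3 * s + 2)
star-pebbling s s+1<n with m≤n⇒∃[o]m+o≡n s+1<n
... | r , refl = star-solvable _ s , star-unsolvable s r

absDiff-+ : ∀ m d → absDiff (m + d) m ≡ d
absDiff-+ m d = trans (cong₂ _⊔_ (m+n∸m≡n m d) (m≤n⇒m∸n≡0 (m≤m+n m d))) (⊔-identityʳ d)

theorem19 : (t : ℕ) → 1 ≤ t → (k : ℕ) → 1 ≤ k →
    Σ ℕ λ N → (n : ℕ) → N ≤ n → 1 ≤ n →
      Σ ℕ λ a → Σ ℕ λ b →
        IsPebblingNumber (StarAdj n) (suc t) a × IsPebblingNumber (StarAdj n) t b
          × k * absDiff a b < b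
theorem19 (suc s) _ k _ = k * 3 + suc (suc (suc s)) , λ n N≤n _ →
  let s+2<n = ≤-trans (m≤n+m _ (k * 3)) N≤n
  in n + 3 * suc s + 2 , n + 3 * s + 2 ,
     star-pebbling (suc s) s+2<n , star-pebbling s (<⇒≤ s+2<n) , gap n N≤n
  where
  gap : ∀ n → k * 3 + suc (suc (suc s)) ≤ n → k * absDiff (n + 3 * suc s + 2) (n + 3 * s + 2) < n + 3 * s + 2
  gap n N≤n = begin-strict
    k * absDiff (n + 3 * suc s + 2) (n + 3 * s + 2)  ≡⟨ cong (λ a → k * absDiff a (n + 3 * s + 2)) (shift n s) ⟩
    k * absDiff (n + 3 * s + 2 + 3) (n + 3 * s + 2)  ≡⟨ cong (k *_) (absDiff-+ (n + 3 * s + 2) 3) ⟩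
    k * 3                                            <⟨ m<m+n (k * 3) z<s ⟩
    k * 3 + suc (suc (suc s))                        ≤⟨ N≤n ⟩
    n                                                ≤⟨ m≤m+n n (3 * s + 2) ⟩
    n + (3 * s + 2)                                  ≡⟨ +-assoc n (3 * s) 2 ⟨
    n + 3 * s + 2                                    ∎
    where
    open ≤-Reasoning
    shift : ∀ n s → n + 3 * suc s + 2 ≡ n + 3 * s + 2 + 3
    shift = solve-∀
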